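{- Let $SOL$ be a valid schedule for $A$ and $\upsilon>1$, and let $SOL'=TA(SOL,\upsilon)$. Then $SOL'$ is a valid schedule for $A$ with $SOL'(A)=\upsilon\cdot SOL(A)$. If moreover $\upsilon\ge(1+\delta)^3$, then $SOL'$ is a timely (in particular valid) schedule for $A'$.
   Context: Let $0<\delta\le1/36$ with $1/\delta$ an integer. Instance $A$: jobs with sizes $a_j>0$, weights $\omega_j>0$, release dates $\rho_j\ge0$; machines with speeds $1=v_1\ge\dots\ge v_m>0$. With $\beta=\delta^2\min_ja_j$, instance $A'$ has the same jobs and machines, with release dates $r'_j=(1+\delta)^{\lceil\log_{1+\delta}(\rho_j+\beta)\rceil}$, speeds $s_i=(1+\delta)^{\lfloor\log_{1+\delta}v_i\rfloor}$, weights $w_j=(1+\delta)^{\lceil\log_{1+\delta}\omega_j\rceil}$, sizes $p_j=(1+\delta)^{\lceil\log_{1+\delta}a_j\rceil}$. A schedule assigns each job a machine and a completion time $C_j$; it is valid for $A$ if each job $j$ on machine $i$ occupies $[C_j-a_j/v_i,C_j)$, starting no earlier than $\rho_j$, with disjoint intervals on each machine (analogously for $A'$ using $p_j,s_i,r'_j$). Cost: $SOL(A)=\sum_j\omega_jC_j$, $SOL(A')=\sum_jw_jC_j$. The time-augmented schedule $TA(SOL,\upsilon)$ assigns every job to the same machine as $SOL$, with completion time $\upsilon$ times its completion time in $SOL$. A schedule for $A'$ is timely if every job $j$ assigned to machine $i$ has starting time at least $\delta p_j/s_i$. -}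

module Defs where

open import Data.Nat as ℕ using (ℕ; zero; suc)
open import Data.Integer as ℤ using (ℤ; +_; -[1+_])
open import Data.Fin using (Fin; zero; suc; toℕ)
open import Data.Product using (Σ; _×_; _,_)
open import Data.Sum using (_⊎_; inj₁; inj₂)
open import Relation.Binary.PropositionalEquality using (_≡_)
open import Relation.Binary.Structures using (IsTotalOrder)
open import Relation.Nullary using (¬_)
open import Algebra.Structures using (IsCommutativeRing)

-- An ordered field (with propositional equality).  ℝ is an instance;
-- the paper's statement is the instance F = ℝ.
record OrderedField : Set₁ where
  infixl 6 _+_ _-_
  infixl 7 _*_ _/_
  infix 4 _≤_ _<_
  field
    Carrier : Set
    _+_ _*_ : Carrier → Carrier → Carrier
    -_      : Carrier → Carrier
    0# 1#   : Carrier
    _⁻¹     : Carrier → Carrier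
    _≤_     : Carrier → Carrier → Set
    isCommutativeRing : IsCommutativeRing _≡_ _+_ _*_ -_ 0# 1#
    isTotalOrder      : IsTotalOrder _≡_ _≤_
    +-mono-≤  : ∀ {x y} z → x ≤ y → x + z ≤ y + z
    *-nonneg  : ∀ {x y} → 0# ≤ x → 0# ≤ y → 0# ≤ x * y
    ⁻¹-inverse : ∀ {x} → ¬ (x ≡ 0#) → x * (x ⁻¹) ≡ 1#
    0≢1       : ¬ (0# ≡ 1#)

  _-_ : Carrier → Carrier → Carrier
  x - y = x + (- y)

  _/_ : Carrier → Carrier → Carrier
  x / y = x * (y ⁻¹)

  _<_ : Carrier → Carrier → Set
  x < y = (x ≤ y) × ¬ (x ≡ y)

  total : ∀ x y → (x ≤ y) ⊎ (y ≤ x)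
  total = IsTotalOrder.total isTotalOrder

  fromℕ : ℕ → Carrier
  fromℕ zero    = 0#
  fromℕ (suc n) = 1# + fromℕ n

  powℕ : Carrier → ℕ → Carrier
  powℕ x zero    = 1#
  powℕ x (suc n) = x * powℕ x n

  pow : Carrier → ℤ → Carrier
  pow x (+ n)      = powℕ x n
  pow x -[1+ n ]   = (powℕ x (suc n)) ⁻¹

  min : Carrier → Carrier → Carrier
  min x y with total x y
  ... | inj₁ _ = x
  ... | inj₂ _ = y

  minF : ∀ {n} → (Fin (suc n) → Carrier) → Carrier
  minF {zero}  f = f zero
  minF {suc n} f = min (f zero) (minF (λ j → f (suc j)))

  sumF : ∀ {n} → (Fin n → Carrier) → Carrier
  sumF {zero}  f = 0#
  sumF {suc n} f = f zero + sumF (λ j → f (suc j))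

  -- y = (1+δ)^⌈log_{1+δ} x⌉
  RoundUp : Carrier → Carrier → Carrier → Set
  RoundUp δ x y = Σ ℤ λ k → (y ≡ pow (1# + δ) k)
                   × (pow (1# + δ) (k ℤ.- ℤ.1ℤ) < x) × (x ≤ y)

  -- y = (1+δ)^⌊log_{1+δ} x⌋
  RoundDown : Carrier → Carrier → Carrier → Set
  RoundDown δ x y = Σ ℤ λ k → (y ≡ pow (1# + δ) k)
                   × (y ≤ x) × (x < pow (1# + δ) (k ℤ.+ ℤ.1ℤ))

  -- 0 < δ ≤ 1/36 and 1/δ an integer, i.e. δ = 1/N for an integer N ≥ 36
  DeltaOK : Carrier → Set
  DeltaOK δ = Σ ℕ λ N → (36 ℕ.≤ N) × (δ * fromℕ N ≡ 1#)

  record Schedule (n m : ℕ) : Set where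
    constructor mkSchedule
    field
      machine : Fin n → Fin m
      C       : Fin n → Carrier

  open Schedule public

  start : ∀ {n m} → (Fin n → Carrier) → (Fin m → Carrier)
        → Schedule n m → Fin n → Carrier
  start size speed S j = C S j - size j / speed (machine S j)

  Valid : ∀ {n m} → (size : Fin n → Carrier) → (speed : Fin m → Carrier)
        → (release : Fin n → Carrier) → Schedule n m → Set
  Valid size speed release S =
    (∀ j → release j ≤ start size speed S j)
    × (∀ j k → ¬ (j ≡ k) → machine S j ≡ machine S k →
         (C S j ≤ start size speed S k) ⊎ (C S k ≤ start size speed S j))

  cost : ∀ {n m} → (Fin n → Carrier) → Schedule n m → Carrier
  cost weight S = sumF (λ j → weight j * C S j)

  TA : ∀ {n m} → Schedule n m → Carrier → Schedule n m
  TA S υ = mkSchedule (machine S) (λ j → υ * C S j)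

  Timely : ∀ {n m} → Carrier → (size : Fin n → Carrier)
         → (speed : Fin m → Carrier) → Schedule n m → Set
  Timely δ size speed S =
    ∀ j → δ * (size j / speed (machine S j)) ≤ start size speed S j

module Submission where

open import Defs
open import Data.Nat using (ℕ; suc)
open import Data.Integer using (+_)
open import Data.Fin using (Fin; zero; toℕ)
open import Data.Product using (_×_)
open import Relation.Binary.PropositionalEquality using (_≡_)

open import Level using (0ℓ)
open import Data.Nat using (zero; z≤n)
import Data.Nat.Properties as ℕ
open import Data.Integer as ℤ using (-[1+_])
import Data.Integer.Properties as ℤ
open import Data.Fin using (suc)
open import Data.Product using (_,_; proj₁; proj₂)
open import Data.Sum as Sum using (inj₁; inj₂)
open import Relation.Nullary using (¬_)
open import Relation.Binary.PropositionalEquality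
  using (refl; sym; trans; cong; subst; subst₂; module ≡-Reasoning)
open import Relation.Binary.Bundles using (Poset)
open import Relation.Binary.Structures using (IsTotalOrder)
import Relation.Binary.Reasoning.PartialOrder
open import Algebra.Bundles using (CommutativeRing)
open import Algebra.Structures using (IsCommutativeRing)

-- Time augmentation (Lemma 12).  Write q = 1 + δ, X_j = a_j / v_i and P_j = p_j / s_i for
-- the original and rounded processing times of job j on its machine i.
--
-- The theorem applies TA-valid twice: with the data of A itself (bounds by υ ≥ 1), and
-- with the rounded data of A' (bounds from Rounding); timeliness is the same start-time
-- estimate with δ P_j in place of r'_j.

module OrderedFieldFacts (F : OrderedField) where
  open OrderedField F
  open IsCommutativeRing isCommutativeRing public
    using (+-assoc; +-comm; +-identityˡ; +-identityʳ; -‿inverseʳ; -‿inverseˡ;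
           *-assoc; *-comm; *-identityˡ; *-identityʳ; distribˡ; zeroˡ; zeroʳ)

  commutativeRing : CommutativeRing 0ℓ 0ℓ
  commutativeRing = record { isCommutativeRing = isCommutativeRing }

  open import Algebra.Properties.Ring (CommutativeRing.ring commutativeRing)
    using (-‿distribˡ-*; -‿distribʳ-*; -‿involutive)
  open import Algebra.Solver.Ring.NaturalCoefficients.Default
    (CommutativeRing.commutativeSemiring commutativeRing) public
    using (solve; _:+_; _:*_; con; _:=_)

  poset : Poset 0ℓ 0ℓ 0ℓ
  poset = record { isPartialOrder = IsTotalOrder.isPartialOrder isTotalOrder }

  module ≤-Reasoning = Relation.Binary.Reasoning.PartialOrder poset

  ≤-refl : ∀ {x} → x ≤ x
  ≤-refl = IsTotalOrder.refl isTotalOrder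

  ≤-trans : ∀ {x y z} → x ≤ y → y ≤ z → x ≤ z
  ≤-trans = IsTotalOrder.trans isTotalOrder

  ≤-antisym : ∀ {x y} → x ≤ y → y ≤ x → x ≡ y
  ≤-antisym = IsTotalOrder.antisym isTotalOrder

  +-monoʳ-≤ : ∀ z {x y} → x ≤ y → z + x ≤ z + y
  +-monoʳ-≤ z {x} {y} x≤y = subst₂ _≤_ (+-comm x z) (+-comm y z) (+-mono-≤ z x≤y)

  +-mono₂-≤ : ∀ {x y u w} → x ≤ y → u ≤ w → x + u ≤ y + w
  +-mono₂-≤ {y = y} {u} x≤y u≤w = ≤-trans (+-mono-≤ u x≤y) (+-monoʳ-≤ y u≤w)

  +-nonneg : ∀ {x y} → 0# ≤ x → 0# ≤ y → 0# ≤ x + y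
  +-nonneg 0≤x 0≤y = subst (_≤ _) (+-identityˡ 0#) (+-mono₂-≤ 0≤x 0≤y)

  +⇒≤- : ∀ {x d c} → x + d ≤ c → x ≤ c - d
  +⇒≤- {x} {d} {c} h = subst (_≤ c - d) cancel (+-mono-≤ (- d) h)
    where
      cancel : x + d - d ≡ x
      cancel = trans (+-assoc x d (- d)) (trans (cong (_+_ x) (-‿inverseʳ d)) (+-identityʳ x))

  ≤-⇒+ : ∀ {x d c} → x ≤ c - d → x + d ≤ c
  ≤-⇒+ {x} {d} {c} h = subst (x + d ≤_) cancel (+-mono-≤ d h)
    where
      cancel : c - d + d ≡ c
      cancel = trans (+-assoc c (- d) d) (trans (cong (_+_ c) (-‿inverseˡ d)) (+-identityʳ c))

  square-nonneg : ∀ x → 0# ≤ x * x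
  square-nonneg x with total 0# x
  ... | inj₁ 0≤x = *-nonneg 0≤x 0≤x
  ... | inj₂ x≤0 = subst (0# ≤_) neg-square (*-nonneg 0≤-x 0≤-x)
    where
      neg-square : - x * - x ≡ x * x
      neg-square = begin
        - x * - x     ≡⟨ sym (-‿distribˡ-* x (- x)) ⟩
        - (x * - x)   ≡⟨ cong -_ (sym (-‿distribʳ-* x x)) ⟩
        - - (x * x)   ≡⟨ -‿involutive (x * x) ⟩
        x * x         ∎
        where open ≡-Reasoning
      0≤-x : 0# ≤ - x
      0≤-x = subst (0# ≤_) (+-identityˡ (- x)) (+⇒≤- (subst (_≤ 0#) (sym (+-identityˡ x)) x≤0))

  0≤1 : 0# ≤ 1#
  0≤1 = subst (0# ≤_) (*-identityˡ 1#) (square-nonneg 1#)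

  fromℕ-nonneg : ∀ n → 0# ≤ fromℕ n
  fromℕ-nonneg zero    = ≤-refl
  fromℕ-nonneg (suc n) = +-nonneg 0≤1 (fromℕ-nonneg n)

  *-monoˡ-≤ : ∀ {c x y} → 0# ≤ c → x ≤ y → c * x ≤ c * y
  *-monoˡ-≤ {c} {x} {y} 0≤c x≤y =
    subst₂ _≤_ (+-identityˡ (c * x)) recombine (+-mono-≤ (c * x) 0≤c[y-x])
    where
      0≤c[y-x] : 0# ≤ c * (y - x)
      0≤c[y-x] = *-nonneg 0≤c (+⇒≤- (subst (_≤ y) (sym (+-identityˡ x)) x≤y))
      recombine : c * (y - x) + c * x ≡ c * y
      recombine = begin
        c * (y - x) + c * x       ≡⟨ cong (_+ c * x) (distribˡ c y (- x)) ⟩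
        c * y + c * - x + c * x   ≡⟨ +-assoc (c * y) (c * - x) (c * x) ⟩
        c * y + (c * - x + c * x) ≡⟨ cong (_+_ (c * y)) (sym (distribˡ c (- x) x)) ⟩
        c * y + c * (- x + x)     ≡⟨ cong (λ z → c * y + c * z) (-‿inverseˡ x) ⟩
        c * y + c * 0#            ≡⟨ cong (_+_ (c * y)) (zeroʳ c) ⟩
        c * y + 0#                ≡⟨ +-identityʳ (c * y) ⟩
        c * y                     ∎
        where open ≡-Reasoning

  *-monoʳ-≤ : ∀ {c x y} → 0# ≤ c → x ≤ y → x * c ≤ y * c
  *-monoʳ-≤ {c} {x} {y} 0≤c x≤y = subst₂ _≤_ (*-comm c x) (*-comm c y) (*-monoˡ-≤ 0≤c x≤y)

  *-mono-≤ : ∀ {x x' y y'} → 0# ≤ x → 0# ≤ y' → x ≤ x' → y ≤ y' → x * y ≤ x' * y'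
  *-mono-≤ 0≤x 0≤y' x≤x' y≤y' = ≤-trans (*-monoˡ-≤ 0≤x y≤y') (*-monoʳ-≤ 0≤y' x≤x')

  ≤-scale : ∀ {u x} → 1# ≤ u → 0# ≤ x → x ≤ u * x
  ≤-scale {u} {x} 1≤u 0≤x = subst (_≤ u * x) (*-identityˡ x) (*-monoʳ-≤ 0≤x 1≤u)

  pos⇒nonneg : ∀ {x} → 0# < x → 0# ≤ x
  pos⇒nonneg = proj₁

  *-inverse : ∀ {x} → 0# < x → x * x ⁻¹ ≡ 1#
  *-inverse (_ , 0≢x) = ⁻¹-inverse (λ x≡0 → 0≢x (sym x≡0))

  *-pos : ∀ {x y} → 0# < x → 0# < y → 0# < x * y
  *-pos {x} {y} 0<x (0≤y , 0≢y) = *-nonneg (pos⇒nonneg 0<x) 0≤y , λ 0≡xy → 0≢y (begin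
      0#             ≡⟨ sym (zeroʳ (x ⁻¹)) ⟩
      x ⁻¹ * 0#      ≡⟨ cong (x ⁻¹ *_) 0≡xy ⟩
      x ⁻¹ * (x * y) ≡⟨ solve 3 (λ w x y → w :* (x :* y) := (x :* w) :* y) refl (x ⁻¹) x y ⟩
      x * x ⁻¹ * y   ≡⟨ cong (_* y) (*-inverse 0<x) ⟩
      1# * y         ≡⟨ *-identityˡ y ⟩
      y              ∎)
    where open ≡-Reasoning

  ⁻¹-pos : ∀ {x} → 0# < x → 0# < x ⁻¹
  ⁻¹-pos {x} 0<x = subst (0# ≤_) x⁻¹-as-product (*-nonneg (pos⇒nonneg 0<x) (square-nonneg (x ⁻¹)))
                 , λ 0≡x⁻¹ → 0≢1 (trans (sym (zeroʳ x)) (trans (cong (x *_) 0≡x⁻¹) (*-inverse 0<x)))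
    where
      x⁻¹-as-product : x * (x ⁻¹ * x ⁻¹) ≡ x ⁻¹
      x⁻¹-as-product = trans (sym (*-assoc x (x ⁻¹) (x ⁻¹)))
                             (trans (cong (_* x ⁻¹) (*-inverse 0<x)) (*-identityˡ (x ⁻¹)))

  ⁻¹-unique : ∀ {x y} → x * y ≡ 1# → y ≡ x ⁻¹
  ⁻¹-unique {x} {y} xy≡1 = begin
      y                ≡⟨ sym (*-identityʳ y) ⟩
      y * 1#           ≡⟨ cong (y *_) (sym (⁻¹-inverse x≢0)) ⟩
      y * (x * x ⁻¹)   ≡⟨ solve 3 (λ x y w → y :* (x :* w) := (x :* y) :* w) refl x y (x ⁻¹) ⟩
      (x * y) * x ⁻¹   ≡⟨ cong (_* x ⁻¹) xy≡1 ⟩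
      1# * x ⁻¹        ≡⟨ *-identityˡ (x ⁻¹) ⟩
      x ⁻¹             ∎
    where
      open ≡-Reasoning
      x≢0 : ¬ x ≡ 0#
      x≢0 x≡0 = 0≢1 (trans (sym (zeroˡ y)) (trans (cong (_* y) (sym x≡0)) xy≡1))

  ⁻¹-cancel : ∀ {x y} → 0# < x → 0# < y → x * (x * y) ⁻¹ ≡ y ⁻¹
  ⁻¹-cancel {x} {y} 0<x 0<y = ⁻¹-unique (trans
      (solve 3 (λ x y w → y :* (x :* w) := (x :* y) :* w) refl x y ((x * y) ⁻¹))
      (*-inverse (*-pos 0<x 0<y)))

  ⁻¹-bound : ∀ {c x y} → 0# < x → 0# < y → 0# ≤ c → x ≤ c * y → y ⁻¹ ≤ c * x ⁻¹
  ⁻¹-bound {c} {x} {y} 0<x 0<y 0≤c x≤cy = begin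
      y ⁻¹                        ≡⟨ sym y⁻¹x⁻¹x≡y⁻¹ ⟩
      (y ⁻¹ * x ⁻¹) * x           ≤⟨ *-monoˡ-≤ (*-nonneg (pos⇒nonneg (⁻¹-pos 0<y)) (pos⇒nonneg (⁻¹-pos 0<x))) x≤cy ⟩
      (y ⁻¹ * x ⁻¹) * (c * y)     ≡⟨ solve 4 (λ v w c y → (v :* w) :* (c :* y) := c :* w :* (y :* v)) refl (y ⁻¹) (x ⁻¹) c y ⟩
      c * x ⁻¹ * (y * y ⁻¹)       ≡⟨ cong (c * x ⁻¹ *_) (*-inverse 0<y) ⟩
      c * x ⁻¹ * 1#               ≡⟨ *-identityʳ (c * x ⁻¹) ⟩
      c * x ⁻¹                    ∎
    where
      open ≤-Reasoning
      y⁻¹x⁻¹x≡y⁻¹ : (y ⁻¹ * x ⁻¹) * x ≡ y ⁻¹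
      y⁻¹x⁻¹x≡y⁻¹ = trans (solve 3 (λ v w x → (v :* w) :* x := v :* (x :* w)) refl (y ⁻¹) (x ⁻¹) x)
                          (trans (cong (y ⁻¹ *_) (*-inverse 0<x)) (*-identityʳ (y ⁻¹)))

  ⁻¹-≥1 : ∀ {v} → 0# < v → v ≤ 1# → 1# ≤ v ⁻¹
  ⁻¹-≥1 {v} 0<v v≤1 = begin
      1#          ≡⟨ sym (*-inverse 0<v) ⟩
      v * v ⁻¹    ≤⟨ *-monoʳ-≤ (pos⇒nonneg (⁻¹-pos 0<v)) v≤1 ⟩
      1# * v ⁻¹   ≡⟨ *-identityˡ (v ⁻¹) ⟩
      v ⁻¹        ∎
    where open ≤-Reasoning

  powℕ-pos : ∀ {x} → 0# < x → ∀ n → 0# < powℕ x n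
  powℕ-pos 0<x zero    = 0≤1 , 0≢1
  powℕ-pos 0<x (suc n) = *-pos 0<x (powℕ-pos 0<x n)

  pow-pos : ∀ {x} → 0# < x → ∀ k → 0# < pow x k
  pow-pos 0<x (+ n)    = powℕ-pos 0<x n
  pow-pos 0<x -[1+ n ] = ⁻¹-pos (powℕ-pos 0<x (suc n))

  pow-pred : ∀ {x} → 0# < x → ∀ k → pow x k ≡ x * pow x (k ℤ.- ℤ.1ℤ)
  pow-pred {x} 0<x (+ zero)  = sym (trans (⁻¹-cancel 0<x (0≤1 , 0≢1)) 1⁻¹≡1)
    where
      1⁻¹≡1 : 1# ⁻¹ ≡ 1#
      1⁻¹≡1 = sym (⁻¹-unique (*-identityˡ 1#))
  pow-pred 0<x (+ suc n) = refl
  pow-pred {x} 0<x -[1+ n ] rewrite ℕ.+-identityʳ n = sym (⁻¹-cancel 0<x (powℕ-pos 0<x (suc n)))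

  pow-succ : ∀ {x} → 0# < x → ∀ k → pow x (k ℤ.+ ℤ.1ℤ) ≡ x * pow x k
  pow-succ {x} 0<x k = trans (pow-pred 0<x (k ℤ.+ ℤ.1ℤ)) (cong (λ i → x * pow x i) [k+1]-1≡k)
    where
      [k+1]-1≡k : k ℤ.+ ℤ.1ℤ ℤ.- ℤ.1ℤ ≡ k
      [k+1]-1≡k = trans (ℤ.+-assoc k ℤ.1ℤ ℤ.-1ℤ) (ℤ.+-identityʳ k)

  min-≤ˡ : ∀ x y → min x y ≤ x
  min-≤ˡ x y with total x y
  ... | inj₁ _   = ≤-refl
  ... | inj₂ y≤x = y≤x

  min-≤ʳ : ∀ x y → min x y ≤ y
  min-≤ʳ x y with total x y
  ... | inj₁ x≤y = x≤y
  ... | inj₂ _   = ≤-refl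

  minF-≤ : ∀ {n} (f : Fin (suc n) → Carrier) j → minF f ≤ f j
  minF-≤ {zero}  f zero    = ≤-refl
  minF-≤ {suc n} f zero    = min-≤ˡ _ _
  minF-≤ {suc n} f (suc j) = ≤-trans (min-≤ʳ _ _) (minF-≤ (λ i → f (suc i)) j)

  sumF-scale : ∀ {n} (w g : Fin n → Carrier) u →
               sumF (λ j → w j * (u * g j)) ≡ u * sumF (λ j → w j * g j)
  sumF-scale {zero}  w g u = sym (zeroʳ u)
  sumF-scale {suc n} w g u = begin
      w zero * (u * g zero) + sumF (λ j → w (suc j) * (u * g (suc j)))
        ≡⟨ cong (_+_ (w zero * (u * g zero))) (sumF-scale (λ j → w (suc j)) (λ j → g (suc j)) u) ⟩
      w zero * (u * g zero) + u * sumF (λ j → w (suc j) * g (suc j))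
        ≡⟨ solve 4 (λ w u g s → w :* (u :* g) :+ u :* s := u :* (w :* g :+ s)) refl (w zero) u (g zero) _ ⟩
      u * (w zero * g zero + sumF (λ j → w (suc j) * g (suc j)))
        ∎
    where open ≡-Reasoning

  ≤-/-slow : ∀ {a v} → 0# ≤ a → 0# < v → v ≤ 1# → a ≤ a / v
  ≤-/-slow {a} {v} 0≤a 0<v v≤1 = subst (a ≤_) (*-comm (v ⁻¹) a) (≤-scale (⁻¹-≥1 0<v v≤1) 0≤a)

  /-nonneg : ∀ {a v} → 0# ≤ a → 0# < v → 0# ≤ a / v
  /-nonneg 0≤a 0<v = *-nonneg 0≤a (pos⇒nonneg (⁻¹-pos 0<v))

  -- 1/δ = N for a natural number N forces δ ≥ 0, as δ = δ² N.
  deltaOK-nonneg : ∀ {δ} → DeltaOK δ → 0# ≤ δ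
  deltaOK-nonneg {δ} (N , _ , δN≡1) = subst (0# ≤_) δ²N≡δ (*-nonneg (square-nonneg δ) (fromℕ-nonneg N))
    where
      δ²N≡δ : δ * δ * fromℕ N ≡ δ
      δ²N≡δ = trans (*-assoc δ δ (fromℕ N)) (trans (cong (δ *_) δN≡1) (*-identityʳ δ))

module Rounding (F : OrderedField) (δ : OrderedField.Carrier F)
                (0≤δ : OrderedField._≤_ F (OrderedField.0# F) δ) where
  open OrderedField F
  open OrderedFieldFacts F

  q : Carrier
  q = 1# + δ

  q³ : Carrier
  q³ = pow q (+ 3)

  δ≤q : δ ≤ q
  δ≤q = subst (_≤ q) (+-identityˡ δ) (+-mono-≤ δ 0≤1)

  1≤q : 1# ≤ q
  1≤q = subst (_≤ q) (+-identityʳ 1#) (+-monoʳ-≤ 1# 0≤δ)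

  0≤q : 0# ≤ q
  0≤q = ≤-trans 0≤1 1≤q

  0<q : 0# < q
  0<q = 0≤q , λ 0≡q → 0≢1 (≤-antisym 0≤1 (subst (1# ≤_) (sym 0≡q) 1≤q))

  q²≤q³ : q * q ≤ q³
  q²≤q³ = subst (q * q ≤_) (cong (λ z → q * (q * z)) (sym (*-identityʳ q)))
                (≤-scale 1≤q (*-nonneg 0≤q 0≤q))

  q≤q³ : q ≤ q³
  q≤q³ = ≤-trans (≤-scale 1≤q 0≤q) q²≤q³

  roundUp-bound : ∀ {x y} → RoundUp δ x y → 0# < y × y ≤ q * x
  roundUp-bound {x} {y} (k , y≡q^k , q^[k-1]<x , _) =
      subst (0# <_) (sym y≡q^k) (pow-pos 0<q k)
    , subst (_≤ q * x) (sym (trans y≡q^k (pow-pred 0<q k))) (*-monoˡ-≤ 0≤q (proj₁ q^[k-1]<x))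

  roundDown-bound : ∀ {x y} → RoundDown δ x y → 0# < y × x ≤ q * y
  roundDown-bound {x} {y} (k , y≡q^k , _ , x<q^[k+1]) =
      subst (0# <_) (sym y≡q^k) (pow-pos 0<q k)
    , subst (x ≤_) (trans (pow-succ 0<q k) (cong (q *_) (sym y≡q^k))) (proj₁ x<q^[k+1])

  rounded-duration-≤ : ∀ {a v p s} → 0# < a → 0# < v → RoundUp δ a p → RoundDown δ v s →
                       p / s ≤ q * q * (a / v)
  rounded-duration-≤ {a} {v} {p} {s} 0<a 0<v a↑p v↓s = begin
      p * s ⁻¹              ≤⟨ *-mono-≤ (pos⇒nonneg 0<p) (*-nonneg 0≤q (pos⇒nonneg (⁻¹-pos 0<v))) p≤qa s⁻¹≤qv⁻¹ ⟩
      (q * a) * (q * v ⁻¹)  ≡⟨ solve 3 (λ q a w → (q :* a) :* (q :* w) := q :* q :* (a :* w)) refl q a (v ⁻¹) ⟩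
      q * q * (a * v ⁻¹)    ∎
    where
      open ≤-Reasoning
      0<p : 0# < p
      0<p = proj₁ (roundUp-bound a↑p)
      p≤qa : p ≤ q * a
      p≤qa = proj₂ (roundUp-bound a↑p)
      0<s : 0# < s
      0<s = proj₁ (roundDown-bound v↓s)
      s⁻¹≤qv⁻¹ : s ⁻¹ ≤ q * v ⁻¹
      s⁻¹≤qv⁻¹ = ⁻¹-bound 0<v 0<s 0≤q (proj₂ (roundDown-bound v↓s))

  stretched-duration-≥ : ∀ {X P υ} → 0# ≤ X → P ≤ q * q * X → q³ ≤ υ → P ≤ υ * X
  stretched-duration-≥ 0≤X P≤q²X q³≤υ = ≤-trans P≤q²X (*-monoʳ-≤ 0≤X (≤-trans q²≤q³ q³≤υ))

  -- The rounded release date plus the rounded duration fit into the stretched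
  -- release date plus duration; the additive δ² μ is absorbed by q³ − q² = q² δ.
  stretched-release-≥ : ∀ {ρ X μ r P υ} → 0# ≤ ρ → 0# ≤ X → μ ≤ X →
                        r ≤ q * (ρ + δ * δ * μ) → P ≤ q * q * X → q³ ≤ υ →
                        r + P ≤ υ * (ρ + X)
  stretched-release-≥ {ρ} {X} {μ} {r} {P} {υ} 0≤ρ 0≤X μ≤X r≤ P≤q²X q³≤υ = begin
      r + P                          ≤⟨ +-mono₂-≤ r≤ P≤q²X ⟩
      q * (ρ + δ * δ * μ) + q * q * X ≤⟨ +-mono-≤ (q * q * X) (*-monoˡ-≤ 0≤q (+-monoʳ-≤ ρ δ²μ≤qδX)) ⟩
      q * (ρ + q * δ * X) + q * q * X ≡⟨ solve 3 (λ d ρ X → let q = con 1 :+ d in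
                                          q :* (ρ :+ q :* d :* X) :+ q :* q :* X
                                            := q :* ρ :+ q :* (q :* (q :* con 1)) :* X) refl δ ρ X ⟩
      q * ρ + q³ * X                 ≤⟨ +-mono-≤ (q³ * X) (*-monoʳ-≤ 0≤ρ q≤q³) ⟩
      q³ * ρ + q³ * X                ≡⟨ sym (distribˡ q³ ρ X) ⟩
      q³ * (ρ + X)                   ≤⟨ *-monoʳ-≤ (+-nonneg 0≤ρ 0≤X) q³≤υ ⟩
      υ * (ρ + X)                    ∎
    where
      open ≤-Reasoning
      δ²μ≤qδX : δ * δ * μ ≤ q * δ * X
      δ²μ≤qδX = *-mono-≤ (square-nonneg δ) 0≤X (*-monoʳ-≤ 0≤δ δ≤q) μ≤X

  stretched-timely : ∀ {ρ X P υ} → 0# ≤ ρ → 0# ≤ X → P ≤ q * q * X → q³ ≤ υ →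
                     δ * P + P ≤ υ * (ρ + X)
  stretched-timely {ρ} {X} {P} {υ} 0≤ρ 0≤X P≤q²X q³≤υ = begin
      δ * P + P         ≡⟨ solve 2 (λ d P → d :* P :+ P := (con 1 :+ d) :* P) refl δ P ⟩
      q * P             ≤⟨ *-monoˡ-≤ 0≤q P≤q²X ⟩
      q * (q * q * X)   ≡⟨ solve 2 (λ q X → q :* (q :* q :* X) := q :* (q :* (q :* con 1)) :* X) refl q X ⟩
      q³ * X            ≤⟨ *-monoˡ-≤ (pos⇒nonneg (pow-pos 0<q (+ 3))) X≤ρ+X ⟩
      q³ * (ρ + X)      ≤⟨ *-monoʳ-≤ (+-nonneg 0≤ρ 0≤X) q³≤υ ⟩
      υ * (ρ + X)       ∎
    where
      open ≤-Reasoning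
      X≤ρ+X : X ≤ ρ + X
      X≤ρ+X = subst (_≤ ρ + X) (+-identityˡ X) (+-mono-≤ X 0≤ρ)

module TimeAugmentation (F : OrderedField) where
  open OrderedField F
  open OrderedFieldFacts F

  duration : ∀ {n m} → (Fin n → Carrier) → (Fin m → Carrier) → Schedule n m → Fin n → Carrier
  duration size speed S j = size j / speed (machine S j)

  stretched-start : ∀ {n m} size speed release {S : Schedule n m} {υ x d} j →
                    Valid size speed release S → 0# ≤ υ →
                    x + d ≤ υ * (release j + duration size speed S j) → x ≤ υ * C S j - d
  stretched-start size speed release {S} {υ} {x} {d} j (released , _) 0≤υ x+d≤ =
    +⇒≤- (begin
      x + d                                      ≤⟨ x+d≤ ⟩
      υ * (release j + duration size speed S j)  ≤⟨ *-monoˡ-≤ 0≤υ (≤-⇒+ (released j)) ⟩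
      υ * C S j                                  ∎)
    where open ≤-Reasoning

  stretched-gap : ∀ {υ x y d e} → 0# ≤ υ → x ≤ y - d → e ≤ υ * d → υ * x ≤ υ * y - e
  stretched-gap {υ} {x} {y} {d} {e} 0≤υ x≤y-d e≤υd = +⇒≤- (begin
      υ * x + e      ≤⟨ +-monoʳ-≤ (υ * x) e≤υd ⟩
      υ * x + υ * d  ≡⟨ sym (distribˡ υ x d) ⟩
      υ * (x + d)    ≤⟨ *-monoˡ-≤ 0≤υ (≤-⇒+ x≤y-d) ⟩
      υ * y          ∎)
    where open ≤-Reasoning

  TA-valid : ∀ {n m} size speed release size' speed' release' {S : Schedule n m} {υ} →
             Valid size speed release S → 0# ≤ υ →
             (∀ j → duration size' speed' S j ≤ υ * duration size speed S j) →
             (∀ j → release' j + duration size' speed' S j ≤ υ * (release j + duration size speed S j)) →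
             Valid size' speed' release' (TA S υ)
  TA-valid size speed release _ _ _ valid 0≤υ duration≤ release≤ =
      (λ j → stretched-start size speed release j valid 0≤υ (release≤ j))
    , λ j k j≢k same-machine → Sum.map
        (λ Cj≤ → stretched-gap 0≤υ Cj≤ (duration≤ k))
        (λ Ck≤ → stretched-gap 0≤υ Ck≤ (duration≤ j))
        (proj₂ valid j k j≢k same-machine)

  TA-cost : ∀ {n m} (weight : Fin n → Carrier) (S : Schedule n m) υ →
            cost weight (TA S υ) ≡ υ * cost weight S
  TA-cost weight S υ = sumF-scale weight (C S) υ

mainTheorem12 : (F : OrderedField) → let open OrderedField F in
    ∀ {n m : ℕ} (δ : Carrier) → DeltaOK δ
    → (a ω ρ : Fin (suc n) → Carrier)
    → (∀ j → 0# < a j) → (∀ j → 0# < ω j) → (∀ j → 0# ≤ ρ j)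
    → (v : Fin (suc m) → Carrier)
    → v zero ≡ 1#
    → (∀ i i' → toℕ i Data.Nat.≤ toℕ i' → v i' ≤ v i)
    → (∀ i → 0# < v i)
    → (r' w p : Fin (suc n) → Carrier) → (s : Fin (suc m) → Carrier)
    → (∀ j → RoundUp δ (ρ j + δ * δ * minF a) (r' j))
    → (∀ i → RoundDown δ (v i) (s i))
    → (∀ j → RoundUp δ (ω j) (w j))
    → (∀ j → RoundUp δ (a j) (p j))
    → (SOL : Schedule (suc n) (suc m)) → Valid a v ρ SOL
    → (υ : Carrier) → 1# < υ
    → (Valid a v ρ (TA SOL υ)
    × (cost ω (TA SOL υ) ≡ υ * cost ω SOL)
    × (pow (1# + δ) (+ 3) ≤ υ
    → Timely δ p s (TA SOL υ) × Valid p s r' (TA SOL υ)))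
mainTheorem12 F {n} {m} δ δ-ok a ω ρ 0<a _ 0≤ρ v v₀≡1 v-antitone 0<v r' w p s ρ↑r' v↓s _ a↑p SOL valid υ (1≤υ , _) =
    TA-valid a v ρ a v ρ valid 0≤υ (λ j → ≤-scale 1≤υ (0≤X j)) (λ j → ≤-scale 1≤υ (+-nonneg (0≤ρ j) (0≤X j)))
  , TA-cost ω SOL υ
  , λ q³≤υ →
        (λ j → stretched-start a v ρ j valid 0≤υ (stretched-timely (0≤ρ j) (0≤X j) (P≤q²X j) q³≤υ))
      , TA-valid a v ρ p s r' valid 0≤υ
          (λ j → stretched-duration-≥ (0≤X j) (P≤q²X j) q³≤υ)
          (λ j → stretched-release-≥ (0≤ρ j) (0≤X j) (minF-a≤X j) (proj₂ (roundUp-bound (ρ↑r' j))) (P≤q²X j) q³≤υ)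
  where
    open OrderedField F
    open OrderedFieldFacts F
    open Rounding F δ (deltaOK-nonneg δ-ok)
    open TimeAugmentation F

    0≤υ : 0# ≤ υ
    0≤υ = ≤-trans 0≤1 1≤υ

    X P : Fin (suc n) → Carrier
    X = duration a v SOL
    P = duration p s SOL

    0≤X : ∀ j → 0# ≤ X j
    0≤X j = /-nonneg (pos⇒nonneg (0<a j)) (0<v (machine SOL j))

    P≤q²X : ∀ j → P j ≤ q * q * X j
    P≤q²X j = rounded-duration-≤ (0<a j) (0<v (machine SOL j)) (a↑p j) (v↓s (machine SOL j))

    -- All speeds are at most v₀ = 1, so the smallest size is at most every duration.
    minF-a≤X : ∀ j → minF a ≤ X j
    minF-a≤X j = ≤-trans (minF-≤ a j)
      (≤-/-slow (pos⇒nonneg (0<a j)) (0<v i) (subst (v i ≤_) v₀≡1 (v-antitone zero i z≤n)))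
      where
        i : Fin (suc m)
        i = machine SOL j
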